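{- Let $n\ge 2$ and $S\subseteq\{1,\dots,n-1\}$. In the network $\mathcal N^n$ at parameter values $(\lambda^{n,S},\mu^{n,S})$, the flow $x^{n,S}$ is a feasible flow and satisfies the conditions (SCS) with respect to $S$. Consequently, $\{s\}\cup S$ is the unique minimum $s$--$t$ cut of $\mathcal N^n$ at $(\lambda^{n,S},\mu^{n,S})$.
   Context: **Numbers.** Define $a^n_{sj}, b^n_{sj}$ (for $n\ge1$, $1\le j\le n$), $\theta^n$ and $\phi^n$ (for $n\ge2$) recursively: - $a^1_{s1}=b^1_{s1}=1$; - $\theta^n=3a^{n-1}_{s,n-1}$; - $\phi^2=4$, and $\phi^n=4\sum_{j<n}(\theta^n b^{n-1}_{sj}-3a^{n-1}_{sj})$ for $n>2$; - $a^n_{sj}=4a^{n-1}_{sj}$ and $b^n_{sj}=(1+\theta^n)b^{n-1}_{sj}$ for $j<n$; - $a^n_{sn}=\phi^n$ and $b^n_{sn}=1$. **Network $\mathcal N^n$.** The nodes are $s$, $t$ and $N^n=\{1,\dots,n\}$. The arcs are $s\to j$ and $j\to t$ for $j\in N^n$, and $j\to k$ for $j,k\in N^n$ with $j>k$. Capacities are: - $u^n_{sj}(\lambda,\mu)=a^n_{sj}\lambda+b^n_{sj}\mu$ for all $n\ge1$ and $j\in N^n$; - $u^1_{1t}=1$; - for $n\ge2$ and $j<n$: $u^n_{jt}=u^{n-1}_{jt}+\theta^n b^{n-1}_{sj}$; - $u^n_{nt}=\phi^n/2$; - $u^n_{ij}=u^{n-1}_{ij}$ for $n-1\ge i>j$;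 - $u^n_{nj}=\theta^n b^{n-1}_{sj}-3a^{n-1}_{sj}$ for $j<n$. **Points.** For $S\subseteq N^n$ define the point $(\lambda^{n,S},\mu^{n,S})$ by: - $(\lambda^{1,\emptyset},\mu^{1,\emptyset})=(1/4,1/4)$ and $(\lambda^{1,\{1\}},\mu^{1,\{1\}})=(3/4,3/4)$; - for $n\ge2$ and $S\subseteq N^{n-1}$: $(\lambda^{n,S},\mu^{n,S})=\left(\frac{\lambda^{n-1,S}}{4},\frac{\mu^{n-1,S}+\theta^n}{1+\theta^n}\right)$; - for $n\ge2$ and $S\subseteq N^{n-1}$: $(\lambda^{n,S\cup\{n\}},\mu^{n,S\cup\{n\}})=\left(\frac{\lambda^{n-1,S}+3}{4},\frac{\mu^{n-1,S}}{1+\theta^n}\right)$. **Flows.** For $S\subseteq N^n$ define the flow $x^{n,S}$ by: - $x^{1,\emptyset}_{s1}=x^{1,\emptyset}_{1t}=1/2$ and $x^{1,\{1\}}_{s1}=x^{1,\{1\}}_{1t}=1$. - For $n\ge2$ and $S\subseteq N^{n-1}$, the flow $x^{n,S}$ is given, for $j,i\in N^{n-1}$ with $i>j$, by: - $x^{n,S}_{sj}=x^{n-1,S}_{sj}+\theta^n b^{n-1}_{sj}$; - $x^{n,S}_{jt}=x^{n-1,S}_{jt}+\theta^n b^{n-1}_{sj}$; - $x^{n,S}_{ij}=x^{n-1,S}_{ij}$; - $x^{n,S}_{nj}=0$; - $x^{n,S}_{sn}=x^{n,S}_{nt}=\phi^n\lambda^{n,S}+\mu^{n,S}$. - For $n\ge2$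 and $S\subseteq N^{n-1}$, the flow $x^{n,S\cup\{n\}}$ is given, for $j,i\in N^{n-1}$ with $i>j$, by: - $x_{sj}=x^{n-1,S}_{sj}+3a^{n-1}_{sj}$; - $x_{jt}=x^{n-1,S}_{jt}+\theta^n b^{n-1}_{sj}$; - $x_{ij}=x^{n-1,S}_{ij}$; - $x_{nj}=\theta^n b^{n-1}_{sj}-3a^{n-1}_{sj}$; - $x_{sn}=\phi^n/2+\sum_{j<n}(\theta^n b^{n-1}_{sj}-3a^{n-1}_{sj})$; - $x_{nt}=\phi^n/2$. **(SCS).** A flow $x$ in $\mathcal N^n$ at parameter values $(\lambda,\mu)$, with capacities $u$ evaluated there, satisfies (SCS) with respect to $S\subseteq N^n$ if all of the following hold: - for $j\in S$: $x_{sj}<u_{sj}$ and $x_{jt}=u_{jt}$; - for $j\notin S$: $x_{sj}=u_{sj}$ and $x_{jt}<u_{jt}$; - for $j>k$ with $j\in S$ and $k\notin S$: $x_{jk}=u_{jk}$; - for $j>k$ with $j\notin S$ and $k\in S$: $x_{jk}=0$. A flow is feasible if it satisfies the capacity bounds and flow conservation at internal nodes. The cut "$S$" means the $s$--$t$ cut $\{s\}\cup S$. -}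

module Defs where

open import Data.Nat as ℕ using (ℕ; zero; suc; _≡ᵇ_; _<ᵇ_)
open import Data.Integer using (+_)
open import Data.Rational using (ℚ; 0ℚ; 1ℚ; _+_; _*_; _-_; _÷_; _/_; _<_; _≤_; ≢-nonZero)
open import Data.Rational.Properties using (_≟_)
open import Data.Bool using (Bool; true; false; if_then_else_; T; not; _∧_)
open import Data.Vec using (Vec; []; _∷_)
open import Data.Product using (_×_; _,_; proj₁; proj₂)
open import Relation.Nullary using (yes; no)
open import Relation.Binary.PropositionalEquality using (_≡_)

-- Conventions
--  * All numbers live in ℚ.  `q k` is the natural number k as a rational.
--  * Nodes of N^n = {1,…,n} are natural numbers j with 1 ≤ j ≤ n.
--  * A subset S ⊆ N^n is a `Vec Bool n` whose HEAD records membership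
--    of the largest node n, the tail being a subset of N^(n-1).
--    So "S ⊆ N^(n-1) viewed as a subset of N^n" is  false ∷ S,
--    and "S ∪ {n}" is  true ∷ S.
--  * Tables indexed by a node are functions ℕ → ℚ; only the values
--    at nodes 1 … n are meaningful.

q : ℕ → ℚ
q k = + k / 1

-- total division (the paper only divides by 1 + θ^n > 0)
_÷'_ : ℚ → ℚ → ℚ
p ÷' r with r ≟ 0ℚ
... | yes _  = 0ℚ
... | no r≢0 = _÷_ p r {{≢-nonZero r≢0}}

sumTo : ℕ → (ℕ → ℚ) → ℚ
sumTo zero    f = 0ℚ
sumTo (suc n) f = sumTo n f + f (suc n)

thetaFrom : (ℕ → ℚ) → ℕ → ℚ
thetaFrom aPrev m = q 3 * aPrev (suc m)

phiFrom : (ℕ → ℚ) → (ℕ → ℚ) → ℕ → ℚ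
phiFrom aPrev bPrev zero    = q 4
phiFrom aPrev bPrev (suc k) =
  q 4 * sumTo (suc (suc k))
          (λ j → thetaFrom aPrev (suc k) * bPrev j - q 3 * aPrev j)

-- one step of the recursion: tables for n = m+2 from tables for m+1
abStep : ℕ → (ℕ → ℚ) × (ℕ → ℚ) → (ℕ → ℚ) × (ℕ → ℚ)
abStep m (aP , bP) =
  (λ j → if j <ᵇ suc (suc m) then q 4 * aP j else phiFrom aP bP m) ,
  (λ j → if j <ᵇ suc (suc m) then (1ℚ + thetaFrom aP m) * bP j else 1ℚ)

-- ab n = (j ↦ a^n_{sj} , j ↦ b^n_{sj})
ab : ℕ → (ℕ → ℚ) × (ℕ → ℚ)
ab zero          = (λ _ → 0ℚ) , (λ _ → 0ℚ)
ab (suc zero)    = (λ _ → 1ℚ) , (λ _ → 1ℚ)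
ab (suc (suc m)) = abStep m (ab (suc m))

a : ℕ → ℕ → ℚ
a n = proj₁ (ab n)

b : ℕ → ℕ → ℚ
b n = proj₂ (ab n)

-- θ^n and φ^n (meaningful for n ≥ 2)
θ : ℕ → ℚ
θ (suc (suc m)) = thetaFrom (a (suc m)) m
θ _             = 0ℚ

φ : ℕ → ℚ
φ (suc (suc m)) = phiFrom (a (suc m)) (b (suc m)) m
φ _             = 0ℚ

uS : ℕ → ℚ → ℚ → ℕ → ℚ
uS n λ' μ j = a n j * λ' + b n j * μ

uT : ℕ → ℕ → ℚ
uT zero          j = 0ℚ
uT (suc zero)    j = 1ℚ
uT (suc (suc m)) j =
  if j <ᵇ suc (suc m)
  then uT (suc m) j + θ (suc (suc m)) * b (suc m) j
  else φ (suc (suc m)) ÷' q 2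

uM : ℕ → ℕ → ℕ → ℚ
uM zero          i j = 0ℚ
uM (suc zero)    i j = 0ℚ
uM (suc (suc m)) i j =
  if i ≡ᵇ suc (suc m)
  then θ (suc (suc m)) * b (suc m) j - q 3 * a (suc m) j
  else uM (suc m) i j

inS : ∀ {n} → Vec Bool n → ℕ → Bool
inS []                j = false
inS {suc m} (x ∷ S)   j = if j ≡ᵇ suc m then x else inS S j

point : (n : ℕ) → Vec Bool n → ℚ × ℚ
point zero          []           = 0ℚ , 0ℚ
point (suc zero)    (false ∷ []) = q 1 ÷' q 4 , q 1 ÷' q 4
point (suc zero)    (true  ∷ []) = q 3 ÷' q 4 , q 3 ÷' q 4
point (suc (suc m)) (false ∷ S)  =
  proj₁ (point (suc m) S) ÷' q 4 ,
  (proj₂ (point (suc m) S) + θ (suc (suc m))) ÷' (1ℚ + θ (suc (suc m)))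
point (suc (suc m)) (true ∷ S)   =
  (proj₁ (point (suc m) S) + q 3) ÷' q 4 ,
  proj₂ (point (suc m) S) ÷' (1ℚ + θ (suc (suc m)))

lam : (n : ℕ) → Vec Bool n → ℚ
lam n S = proj₁ (point n S)

mu : (n : ℕ) → Vec Bool n → ℚ
mu n S = proj₂ (point n S)

data Arc : Set where
  sArc : ℕ → Arc
  tArc : ℕ → Arc
  mArc : ℕ → ℕ → Arc    -- i → j  (i > j)

Flow : Set
Flow = Arc → ℚ

flow : (n : ℕ) → Vec Bool n → Flow
flow zero          []           _ = 0ℚ
flow (suc zero)    (false ∷ []) (sArc _)   = q 1 ÷' q 2
flow (suc zero)    (false ∷ []) (tArc _)   = q 1 ÷' q 2
flow (suc zero)    (false ∷ []) (mArc _ _) = 0ℚ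
flow (suc zero)    (true ∷ [])  (sArc _)   = 1ℚ
flow (suc zero)    (true ∷ [])  (tArc _)   = 1ℚ
flow (suc zero)    (true ∷ [])  (mArc _ _) = 0ℚ
flow (suc (suc m)) (false ∷ S)  (sArc j) =
  if j ≡ᵇ suc (suc m)
  then φ (suc (suc m)) * lam (suc (suc m)) (false ∷ S) + mu (suc (suc m)) (false ∷ S)
  else flow (suc m) S (sArc j) + θ (suc (suc m)) * b (suc m) j
flow (suc (suc m)) (false ∷ S)  (tArc j) =
  if j ≡ᵇ suc (suc m)
  then φ (suc (suc m)) * lam (suc (suc m)) (false ∷ S) + mu (suc (suc m)) (false ∷ S)
  else flow (suc m) S (tArc j) + θ (suc (suc m)) * b (suc m) j
flow (suc (suc m)) (false ∷ S)  (mArc i j) =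
  if i ≡ᵇ suc (suc m) then 0ℚ else flow (suc m) S (mArc i j)
flow (suc (suc m)) (true ∷ S)   (sArc j) =
  if j ≡ᵇ suc (suc m)
  then φ (suc (suc m)) ÷' q 2
       + sumTo (suc m) (λ k → θ (suc (suc m)) * b (suc m) k - q 3 * a (suc m) k)
  else flow (suc m) S (sArc j) + q 3 * a (suc m) j
flow (suc (suc m)) (true ∷ S)   (tArc j) =
  if j ≡ᵇ suc (suc m)
  then φ (suc (suc m)) ÷' q 2
  else flow (suc m) S (tArc j) + θ (suc (suc m)) * b (suc m) j
flow (suc (suc m)) (true ∷ S)   (mArc i j) =
  if i ≡ᵇ suc (suc m)
  then θ (suc (suc m)) * b (suc m) j - q 3 * a (suc m) j
  else flow (suc m) S (mArc i j)

Node : ℕ → ℕ → Set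
Node n j = 1 ℕ.≤ j × j ℕ.≤ n

InnerArc : ℕ → ℕ → ℕ → Set
InnerArc n i j = 1 ℕ.≤ j × j ℕ.< i × i ℕ.≤ n

inflow : ℕ → Flow → ℕ → ℚ
inflow n x j = x (sArc j) + sumTo n (λ i → if j <ᵇ i then x (mArc i j) else 0ℚ)

outflow : ℕ → Flow → ℕ → ℚ
outflow n x j = x (tArc j) + sumTo n (λ k → if k <ᵇ j then x (mArc j k) else 0ℚ)

Feasible : (n : ℕ) → ℚ → ℚ → Flow → Set
Feasible n λ' μ x =
  (∀ j → Node n j → 0ℚ ≤ x (sArc j) × x (sArc j) ≤ uS n λ' μ j) ×
  (∀ j → Node n j → 0ℚ ≤ x (tArc j) × x (tArc j) ≤ uT n j) ×
  (∀ i j → InnerArc n i j → 0ℚ ≤ x (mArc i j) × x (mArc i j) ≤ uM n i j) ×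
  (∀ j → Node n j → inflow n x j ≡ outflow n x j)

SCS : (n : ℕ) → ℚ → ℚ → Vec Bool n → Flow → Set
SCS n λ' μ S x =
  (∀ j → Node n j → T (inS S j) →
     x (sArc j) < uS n λ' μ j × x (tArc j) ≡ uT n j) ×
  (∀ j → Node n j → T (not (inS S j)) →
     x (sArc j) ≡ uS n λ' μ j × x (tArc j) < uT n j) ×
  (∀ i j → InnerArc n i j → T (inS S i) → T (not (inS S j)) →
     x (mArc i j) ≡ uM n i j) ×
  (∀ i j → InnerArc n i j → T (not (inS S i)) → T (inS S j) →
     x (mArc i j) ≡ 0ℚ)

cutCap : (n : ℕ) → ℚ → ℚ → Vec Bool n → ℚ
cutCap n λ' μ S =
  sumTo n (λ j → if inS S j then 0ℚ else uS n λ' μ j) +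
  sumTo n (λ j → if inS S j then uT n j else 0ℚ) +
  sumTo n (λ i → sumTo n (λ j →
    if (j <ᵇ i) ∧ inS S i ∧ not (inS S j) then uM n i j else 0ℚ))

UniqueMinCut : (n : ℕ) → ℚ → ℚ → Vec Bool n → Set
UniqueMinCut n λ' μ S = ∀ (S' : Vec Bool n) → S' ≢ S → cutCap n λ' μ S < cutCap n λ' μ S'
  where open import Relation.Binary.PropositionalEquality using (_≢_)

{-# OPTIONS --safe #-}
-- Uniqueness is weak duality with slacks: for a feasible flow x and any cut C,
-- cap(C) = |x| + (nonnegative slacks of x on the nodes and inner arcs, read off from C).
-- (SCS) says all slacks of S vanish, and where C and S disagree on a node, the strict
-- inequality in (SCS) makes a slack of C positive. Passing from 𝒩^(n-1) to 𝒩^n, the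
-- recursion for (λ^{n,S}, μ^{n,S}) raises u_{sj} and u_{jt} of every old node j by exactly
-- what is added to x_{sj} and x_{jt}, and leaves old inner arcs unchanged, so every old
-- condition is inherited; the new node n is saturated on the correct side because the
-- previous point lies in the open unit square and φ^n is large (φ^n ≥ 4 a^{n-1}_{s,n-1} ≥ 4).
module Submission where

open import Defs
open import Data.Nat using (ℕ; suc; _≤_)
open import Data.Bool using (false)
open import Data.Vec using (Vec; _∷_)
open import Data.Bool using (Bool)
open import Data.Product using (_×_)

open import Data.Nat using (zero; z≤n; s≤s; _<_; _≡ᵇ_; _<ᵇ_)
import Data.Nat.Properties as ℕP
open import Data.Rational using (ℚ; 0ℚ; 1ℚ; _+_; _*_; _-_; -_; _≤?_; _<?_; nonNegative; positive; ≢-nonZero; 1/_)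
  renaming (_≤_ to _≤q_; _<_ to _<q_)
open import Data.Rational.Properties
open import Data.Rational.Solver using (module +-*-Solver)
open +-*-Solver using (solve; _:+_; _:-_; _:*_; :-_; _:=_; con)
open import Data.Bool using (true; if_then_else_; T; not; _∧_)
open import Data.Vec using ([])
open import Data.Unit using (tt)
open import Data.Empty using (⊥-elim)
open import Data.Product using (_,_; proj₁; proj₂; Σ-syntax; map)
open import Data.Sum using (_⊎_; inj₁; inj₂)
open import Relation.Binary.PropositionalEquality
open import Relation.Nullary using (yes; no; ¬_)
open import Relation.Nullary.Decidable using (from-yes)

if-T : ∀ {A : Set} {b} {x y : A} → T b → (if b then x else y) ≡ x
if-T {b = true} _ = refl

if-¬T : ∀ {A : Set} {b} {x y : A} → ¬ T b → (if b then x else y) ≡ y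
if-¬T {b = false} _  = refl
if-¬T {b = true}  ¬t = ⊥-elim (¬t tt)

n≡ᵇn : ∀ n → T (n ≡ᵇ n)
n≡ᵇn n = ℕP.≡⇒≡ᵇ n n refl

<⇒¬≡ᵇ : ∀ {m n} → m < n → ¬ T (m ≡ᵇ n)
<⇒¬≡ᵇ {m} {n} m<n t = ℕP.<-irrefl (ℕP.≡ᵇ⇒≡ m n t) m<n

≤⇒¬<ᵇ : ∀ {m n} → n ≤ m → ¬ T (m <ᵇ n)
≤⇒¬<ᵇ {m} {n} n≤m t = ℕP.≤⇒≯ n≤m (ℕP.<ᵇ⇒< m n t)

n≮ᵇn : ∀ n → ¬ T (n <ᵇ n)
n≮ᵇn n = ≤⇒¬<ᵇ (ℕP.≤-refl {n})

p≤q⇒0≤q-p : ∀ {p q} → p ≤q q → 0ℚ ≤q q - p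
p≤q⇒0≤q-p {p} {q} p≤q = subst (_≤q q - p) (+-inverseʳ p) (+-monoˡ-≤ (- p) p≤q)

p<q⇒0<q-p : ∀ {p q} → p <q q → 0ℚ <q q - p
p<q⇒0<q-p {p} {q} p<q = subst (_<q q - p) (+-inverseʳ p) (+-monoˡ-< (- p) p<q)

q-p+p≡q : ∀ q p → (q - p) + p ≡ q
q-p+p≡q = solve 2 (λ q p → (q :- p) :+ p := q) refl

0≤q-p⇒p≤q : ∀ {p q} → 0ℚ ≤q q - p → p ≤q q
0≤q-p⇒p≤q {p} {q} 0≤q-p = subst₂ _≤q_ (+-identityˡ p) (q-p+p≡q q p) (+-monoˡ-≤ p 0≤q-p)

0<q-p⇒p<q : ∀ {p q} → 0ℚ <q q - p → p <q q
0<q-p⇒p<q {p} {q} 0<q-p = subst₂ _<q_ (+-identityˡ p) (q-p+p≡q q p) (+-monoˡ-< p 0<q-p)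

p≡q⇒q-p≡0 : ∀ {p q} → p ≡ q → q - p ≡ 0ℚ
p≡q⇒q-p≡0 {p} refl = +-inverseʳ p

if-nonNeg : ∀ b {p r} → (T b → 0ℚ ≤q p) → (T (not b) → 0ℚ ≤q r) → 0ℚ ≤q (if b then p else r)
if-nonNeg true  0≤p _   = 0≤p tt
if-nonNeg false _   0≤r = 0≤r tt

if-zero : ∀ b {p r} → (T b → p ≡ 0ℚ) → (T (not b) → r ≡ 0ℚ) → (if b then p else r) ≡ 0ℚ
if-zero true  p≡0 _   = p≡0 tt
if-zero false _   r≡0 = r≡0 tt

*-nonNeg : ∀ {p r} → 0ℚ ≤q p → 0ℚ ≤q r → 0ℚ ≤q p * r
*-nonNeg {p} {r} 0≤p 0≤r =
  nonNegative⁻¹ (p * r) {{nonNeg*nonNeg⇒nonNeg p {{nonNegative 0≤p}} r {{nonNegative 0≤r}}}}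

*-pos : ∀ {p r} → 0ℚ <q p → 0ℚ <q r → 0ℚ <q p * r
*-pos {p} {r} 0<p 0<r = positive⁻¹ (p * r) {{pos*pos⇒pos p {{positive 0<p}} r {{positive 0<r}}}}

+-nonNeg : ∀ {p r} → 0ℚ ≤q p → 0ℚ ≤q r → 0ℚ ≤q p + r
+-nonNeg {p} {r} 0≤p 0≤r = subst (_≤q p + r) (+-identityʳ 0ℚ) (+-mono-≤ 0≤p 0≤r)

+-posˡ : ∀ {p r} → 0ℚ <q p → 0ℚ ≤q r → 0ℚ <q p + r
+-posˡ {p} {r} 0<p 0≤r = subst (_<q p + r) (+-identityʳ 0ℚ) (+-mono-<-≤ 0<p 0≤r)

+-posʳ : ∀ {p r} → 0ℚ ≤q p → 0ℚ <q r → 0ℚ <q p + r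
+-posʳ {p} {r} 0≤p 0<r = subst (_<q p + r) (+-identityʳ 0ℚ) (+-mono-≤-< 0≤p 0<r)

*-monoˡ-≤-nonNeg′ : ∀ {p r} c → 0ℚ ≤q c → p ≤q r → c * p ≤q c * r
*-monoˡ-≤-nonNeg′ c 0≤c = *-monoˡ-≤-nonNeg c {{nonNegative 0≤c}}

*-monoʳ-<-pos′ : ∀ {p r} c → 0ℚ <q c → p <q r → c * p <q c * r
*-monoʳ-<-pos′ c 0<c = *-monoʳ-<-pos c {{positive 0<c}}

<-by-factor : ∀ c {p r P R} → 0ℚ ≤q c → c * p ≡ P → c * r ≡ R → P <q R → p <q r
<-by-factor c 0≤c refl refl = *-cancelˡ-<-nonNeg c {{nonNegative 0≤c}}

≤-by-factor : ∀ c {p r P R} → 0ℚ <q c → c * p ≡ P → c * r ≡ R → P ≤q R → p ≤q r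
≤-by-factor c 0<c refl refl = *-cancelˡ-≤-pos c {{positive 0<c}}

*-÷′-cancel : ∀ p r → 0ℚ <q r → r * (p ÷' r) ≡ p
*-÷′-cancel p r 0<r with r ≟ 0ℚ
... | yes r≡0 = ⊥-elim (<-irrefl (sym r≡0) 0<r)
... | no r≢0 = begin
  r * (p * 1/ r)   ≡⟨ solve 3 (λ r p i → r :* (p :* i) := p :* (r :* i)) refl r p _ ⟩
  p * (r * 1/ r)   ≡⟨ cong (p *_) (*-inverseʳ r) ⟩
  p * 1ℚ           ≡⟨ *-identityʳ p ⟩
  p                ∎
  where open ≡-Reasoning
        instance _ = ≢-nonZero r≢0

Node-weaken : ∀ {n j} → Node n j → Node (suc n) j
Node-weaken (1≤j , j≤n) = 1≤j , ℕP.m≤n⇒m≤1+n j≤n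

Node-last : ∀ n → Node (suc n) (suc n)
Node-last n = s≤s z≤n , ℕP.≤-refl

Node-split : ∀ {n j} → Node (suc n) j → j ≡ suc n ⊎ Node n j
Node-split (1≤j , j≤1+n) with ℕP.m≤n⇒m<n∨m≡n j≤1+n
... | inj₂ j≡1+n      = inj₁ j≡1+n
... | inj₁ (s≤s j≤n) = inj₂ (1≤j , j≤n)

sumTo-cong : ∀ n {f g : ℕ → ℚ} → (∀ j → Node n j → f j ≡ g j) → sumTo n f ≡ sumTo n g
sumTo-cong zero    f≡g = refl
sumTo-cong (suc n) f≡g =
  cong₂ _+_ (sumTo-cong n (λ j nd → f≡g j (Node-weaken nd))) (f≡g (suc n) (Node-last n))

sumTo-zero : ∀ n {f : ℕ → ℚ} → (∀ j → Node n j → f j ≡ 0ℚ) → sumTo n f ≡ 0ℚ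
sumTo-zero n {f} f≡0 = trans (sumTo-cong n f≡0) (sumTo-const0 n)
  where sumTo-const0 : ∀ n → sumTo n (λ _ → 0ℚ) ≡ 0ℚ
        sumTo-const0 zero    = refl
        sumTo-const0 (suc n) = trans (+-identityʳ _) (sumTo-const0 n)

sumTo-+ : ∀ n (f g : ℕ → ℚ) → sumTo n (λ j → f j + g j) ≡ sumTo n f + sumTo n g
sumTo-+ zero    f g = sym (+-identityʳ 0ℚ)
sumTo-+ (suc n) f g = trans (cong (_+ (f (suc n) + g (suc n))) (sumTo-+ n f g))
  (solve 4 (λ a b c d → (a :+ b) :+ (c :+ d) := (a :+ c) :+ (b :+ d)) refl
     (sumTo n f) (sumTo n g) (f (suc n)) (g (suc n)))

sumTo-sub : ∀ n (f g : ℕ → ℚ) → sumTo n (λ j → f j - g j) ≡ sumTo n f - sumTo n g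
sumTo-sub zero    f g = refl
sumTo-sub (suc n) f g = trans (cong (_+ (f (suc n) - g (suc n))) (sumTo-sub n f g))
  (solve 4 (λ a b c d → (a :- b) :+ (c :- d) := (a :+ c) :- (b :+ d)) refl
     (sumTo n f) (sumTo n g) (f (suc n)) (g (suc n)))

sumTo-swap : ∀ n m (F : ℕ → ℕ → ℚ) →
             sumTo n (λ i → sumTo m (F i)) ≡ sumTo m (λ j → sumTo n (λ i → F i j))
sumTo-swap zero    m F = sym (sumTo-zero m (λ _ _ → refl))
sumTo-swap (suc n) m F =
  trans (cong (_+ sumTo m (F (suc n))) (sumTo-swap n m F)) (sym (sumTo-+ m _ (F (suc n))))

sumTo-nonNeg : ∀ n {f : ℕ → ℚ} → (∀ j → Node n j → 0ℚ ≤q f j) → 0ℚ ≤q sumTo n f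
sumTo-nonNeg zero    0≤f = ≤-refl
sumTo-nonNeg (suc n) 0≤f =
  +-nonNeg (sumTo-nonNeg n (λ j nd → 0≤f j (Node-weaken nd))) (0≤f (suc n) (Node-last n))

term≤sumTo : ∀ n {f : ℕ → ℚ} → (∀ j → Node n j → 0ℚ ≤q f j) → ∀ k → Node n k → f k ≤q sumTo n f
term≤sumTo zero    0≤f zero    (() , _)
term≤sumTo zero    0≤f (suc k) (_ , ())
term≤sumTo (suc n) {f} 0≤f k nd with Node-split nd
... | inj₁ refl = subst (_≤q sumTo n f + f k) (+-identityˡ (f k))
  (+-monoˡ-≤ (f k) (sumTo-nonNeg n (λ j nd′ → 0≤f j (Node-weaken nd′))))
... | inj₂ nd′ = subst (_≤q sumTo n f + f (suc n)) (+-identityʳ (f k))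
  (+-mono-≤ (term≤sumTo n (λ j nd″ → 0≤f j (Node-weaken nd″)) k nd′) (0≤f (suc n) (Node-last n)))

sumTo-pos : ∀ n {f : ℕ → ℚ} → (∀ j → Node n j → 0ℚ ≤q f j) →
            ∀ k → Node n k → 0ℚ <q f k → 0ℚ <q sumTo n f
sumTo-pos n {f} 0≤f k nd 0<fk = <-≤-trans 0<fk (term≤sumTo n 0≤f k nd)

internal-arcs-cancel : ∀ (l ci cj : Bool) x →
  ((if cj then (if l then x else 0ℚ) else 0ℚ) - (if ci then (if l then x else 0ℚ) else 0ℚ))
  + (if l ∧ ci ∧ not cj then x else (if l ∧ not ci ∧ cj then - x else 0ℚ)) ≡ 0ℚ
internal-arcs-cancel false false false x = refl
internal-arcs-cancel false false true  x = refl
internal-arcs-cancel false true  false x = refl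
internal-arcs-cancel false true  true  x = refl
internal-arcs-cancel true  false false x = refl
internal-arcs-cancel true  false true  x = solve 1 (λ x → (x :- con 0ℚ) :+ (:- x) := con 0ℚ) refl x
internal-arcs-cancel true  true  false x = solve 1 (λ x → (con 0ℚ :- x) :+ x := con 0ℚ) refl x
internal-arcs-cancel true  true  true  x = solve 1 (λ x → (x :- x) :+ con 0ℚ := con 0ℚ) refl x

node-capacity-split : ∀ (cj : Bool) us ut xs xt →
  (if cj then 0ℚ else us) + (if cj then ut else 0ℚ)
  ≡ (xs + (if cj then ut - xt else us - xs)) + (if cj then xt - xs else 0ℚ)
node-capacity-split true  us ut xs xt =
  solve 3 (λ ut xs xt → con 0ℚ :+ ut := (xs :+ (ut :- xt)) :+ (xt :- xs)) refl ut xs xt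
node-capacity-split false us ut xs xt =
  solve 2 (λ us xs → us :+ con 0ℚ := (xs :+ (us :- xs)) :+ con 0ℚ) refl us xs

arc-capacity-split : ∀ (l ci cj : Bool) um x →
  (if l ∧ ci ∧ not cj then um else 0ℚ)
  ≡ (if l ∧ ci ∧ not cj then um - x else (if l ∧ not ci ∧ cj then x else 0ℚ))
    + (if l ∧ ci ∧ not cj then x else (if l ∧ not ci ∧ cj then - x else 0ℚ))
arc-capacity-split false ci    cj    um x = refl
arc-capacity-split true  false false um x = refl
arc-capacity-split true  false true  um x = sym (+-inverseʳ x)
arc-capacity-split true  true  false um x = sym (q-p+p≡q um x)
arc-capacity-split true  true  true  um x = refl

module FeasibleParts (n : ℕ) (λ' μ : ℚ) (x : Flow) (feasible : Feasible n λ' μ x) where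

  source-bounds : ∀ j → Node n j → 0ℚ ≤q x (sArc j) × x (sArc j) ≤q uS n λ' μ j
  source-bounds = proj₁ feasible

  sink-bounds : ∀ j → Node n j → 0ℚ ≤q x (tArc j) × x (tArc j) ≤q uT n j
  sink-bounds = proj₁ (proj₂ feasible)

  arc-bounds : ∀ i j → InnerArc n i j → 0ℚ ≤q x (mArc i j) × x (mArc i j) ≤q uM n i j
  arc-bounds = proj₁ (proj₂ (proj₂ feasible))

  balanced : ∀ j → Node n j → inflow n x j ≡ outflow n x j
  balanced = proj₂ (proj₂ (proj₂ feasible))

module SCSParts (n : ℕ) (λ' μ : ℚ) (S : Vec Bool n) (x : Flow) (scs : SCS n λ' μ S x) where

  in-cut : ∀ j → Node n j → T (inS S j) → x (sArc j) <q uS n λ' μ j × x (tArc j) ≡ uT n j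
  in-cut = proj₁ scs

  out-cut : ∀ j → Node n j → T (not (inS S j)) → x (sArc j) ≡ uS n λ' μ j × x (tArc j) <q uT n j
  out-cut = proj₁ (proj₂ scs)

  leaving-saturated : ∀ i j → InnerArc n i j → T (inS S i) → T (not (inS S j)) → x (mArc i j) ≡ uM n i j
  leaving-saturated = proj₁ (proj₂ (proj₂ scs))

  entering-empty : ∀ i j → InnerArc n i j → T (not (inS S i)) → T (inS S j) → x (mArc i j) ≡ 0ℚ
  entering-empty = proj₂ (proj₂ (proj₂ scs))

module CutDuality (n : ℕ) (λ' μ : ℚ) (x : Flow) where

  ΣΣ : (ℕ → ℕ → ℚ) → ℚ
  ΣΣ F = sumTo n (λ i → sumTo n (F i))

  Leaving Entering : (ℕ → Bool) → ℕ → ℕ → Bool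
  Leaving  c i j = (j <ᵇ i) ∧ c i ∧ not (c j)
  Entering c i j = (j <ᵇ i) ∧ not (c i) ∧ c j

  value : ℚ
  value = sumTo n (λ j → x (sArc j))

  nodeSlack : (ℕ → Bool) → ℕ → ℚ
  nodeSlack c j = if c j then uT n j - x (tArc j) else uS n λ' μ j - x (sArc j)

  arcSlack : (ℕ → Bool) → ℕ → ℕ → ℚ
  arcSlack c i j =
    if Leaving c i j then uM n i j - x (mArc i j) else (if Entering c i j then x (mArc i j) else 0ℚ)

  slack : (ℕ → Bool) → ℚ
  slack c = sumTo n (nodeSlack c) + ΣΣ (arcSlack c)

  excess : (ℕ → Bool) → ℕ → ℚ
  excess c j = if c j then x (tArc j) - x (sArc j) else 0ℚ

  crossing : (ℕ → Bool) → ℕ → ℕ → ℚ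
  crossing c i j =
    if Leaving c i j then x (mArc i j) else (if Entering c i j then - x (mArc i j) else 0ℚ)

  module _ (conserve : ∀ j → Node n j → inflow n x j ≡ outflow n x j) where

    inflowIn outflowIn : (ℕ → Bool) → ℕ → ℕ → ℚ
    inflowIn  c i j = if c j then (if j <ᵇ i then x (mArc i j) else 0ℚ) else 0ℚ
    outflowIn c i j = if c i then (if j <ᵇ i then x (mArc i j) else 0ℚ) else 0ℚ

    excess≡inflow-outflow : ∀ c j → Node n j →
      excess c j ≡ sumTo n (λ i → inflowIn c i j) - sumTo n (outflowIn c j)
    excess≡inflow-outflow c j nd with c j
    ... | false = sym (cong₂ _-_ (sumTo-zero n (λ _ _ → refl)) (sumTo-zero n (λ _ _ → refl)))
    ... | true  = begin
      t - s  ≡⟨ solve 4 (λ s i t o → t :- s := ((t :+ o) :- (s :+ i)) :+ (i :- o))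
                                             refl s into t outof ⟩
      ((t + outof) - (s + into)) + (into - outof)  ≡⟨ cong (λ z → (z - (s + into)) + (into - outof)) (sym (conserve j nd)) ⟩
      ((s + into) - (s + into)) + (into - outof)   ≡⟨ cong (_+ (into - outof)) (+-inverseʳ (s + into)) ⟩
      0ℚ + (into - outof)                          ≡⟨ +-identityˡ (into - outof) ⟩
      into - outof                                 ∎
      where open ≡-Reasoning
            s t into outof : ℚ
            s     = x (sArc j)
            t     = x (tArc j)
            into  = sumTo n (λ i → if j <ᵇ i then x (mArc i j) else 0ℚ)
            outof = sumTo n (λ k → if k <ᵇ j then x (mArc j k) else 0ℚ)

    -- conservation summed over the nodes of the cut: arcs inside the cut cancel
    excess+crossing≡0 : ∀ c → sumTo n (excess c) + ΣΣ (crossing c) ≡ 0ℚ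
    excess+crossing≡0 c = begin
      sumTo n (excess c) + ΣΣ (crossing c)
        ≡⟨ cong (_+ ΣΣ (crossing c)) (sumTo-cong n (excess≡inflow-outflow c)) ⟩
      sumTo n (λ j → sumTo n (λ i → inflowIn c i j) - sumTo n (outflowIn c j)) + ΣΣ (crossing c)
        ≡⟨ cong (_+ ΣΣ (crossing c)) (sumTo-sub n _ _) ⟩
      (sumTo n (λ j → sumTo n (λ i → inflowIn c i j)) - ΣΣ (outflowIn c)) + ΣΣ (crossing c)
        ≡⟨ cong (λ z → (z - ΣΣ (outflowIn c)) + ΣΣ (crossing c)) (sumTo-swap n n (λ j i → inflowIn c i j)) ⟩
      (ΣΣ (inflowIn c) - ΣΣ (outflowIn c)) + ΣΣ (crossing c)
        ≡⟨ cong (_+ ΣΣ (crossing c)) (sym (sumTo-sub n _ _)) ⟩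
      sumTo n (λ i → sumTo n (inflowIn c i) - sumTo n (outflowIn c i)) + ΣΣ (crossing c)
        ≡⟨ sym (sumTo-+ n _ _) ⟩
      sumTo n (λ i → (sumTo n (inflowIn c i) - sumTo n (outflowIn c i)) + sumTo n (crossing c i))
        ≡⟨ sumTo-cong n (λ i _ → trans (cong (_+ sumTo n (crossing c i)) (sym (sumTo-sub n _ _)))
                                        (sym (sumTo-+ n _ _))) ⟩
      ΣΣ (λ i j → (inflowIn c i j - outflowIn c i j) + crossing c i j)
        ≡⟨ sumTo-zero n (λ i _ → sumTo-zero n (λ j _ →
             internal-arcs-cancel (j <ᵇ i) (c i) (c j) (x (mArc i j)))) ⟩
      0ℚ ∎
      where open ≡-Reasoning

    cutCap≡value+slack : ∀ S → cutCap n λ' μ S ≡ value + slack (inS S)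
    cutCap≡value+slack S = begin
      cutCap n λ' μ S
        ≡⟨ cong (_+ ΣΣ capLeaving) (sym (sumTo-+ n _ _)) ⟩
      sumTo n (λ j → (if c j then 0ℚ else uS n λ' μ j) + (if c j then uT n j else 0ℚ)) + ΣΣ capLeaving
        ≡⟨ cong₂ _+_
             (sumTo-cong n (λ j _ → node-capacity-split (c j) _ _ (x (sArc j)) (x (tArc j))))
             (sumTo-cong n (λ i _ → sumTo-cong n (λ j _ →
               arc-capacity-split (j <ᵇ i) (c i) (c j) _ (x (mArc i j))))) ⟩
      sumTo n (λ j → (x (sArc j) + nodeSlack c j) + excess c j)
        + ΣΣ (λ i j → arcSlack c i j + crossing c i j)
        ≡⟨ cong₂ _+_ (trans (sumTo-+ n _ _) (cong (_+ sumTo n (excess c)) (sumTo-+ n _ _)))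
                     (trans (sumTo-cong n (λ i _ → sumTo-+ n _ _)) (sumTo-+ n _ _)) ⟩
      ((value + sumTo n (nodeSlack c)) + sumTo n (excess c)) + (ΣΣ (arcSlack c) + ΣΣ (crossing c))
        ≡⟨ solve 5 (λ v w z s d → ((v :+ w) :+ z) :+ (s :+ d) := (v :+ (w :+ s)) :+ (z :+ d)) refl
             value (sumTo n (nodeSlack c)) (sumTo n (excess c)) (ΣΣ (arcSlack c)) (ΣΣ (crossing c)) ⟩
      (value + slack c) + (sumTo n (excess c) + ΣΣ (crossing c))
        ≡⟨ cong ((value + slack c) +_) (excess+crossing≡0 c) ⟩
      (value + slack c) + 0ℚ
        ≡⟨ +-identityʳ _ ⟩
      value + slack c ∎
      where open ≡-Reasoning
            c : ℕ → Bool
            c = inS S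
            capLeaving : ℕ → ℕ → ℚ
            capLeaving i j = if Leaving c i j then uM n i j else 0ℚ

  innerArc : ∀ {i j} → Node n i → Node n j → T (j <ᵇ i) → InnerArc n i j
  innerArc {i} {j} (_ , i≤n) (1≤j , _) t = 1≤j , ℕP.<ᵇ⇒< j i t , i≤n

  module _ (feasible : Feasible n λ' μ x) where
    open FeasibleParts n λ' μ x feasible

    nodeSlack-nonNeg : ∀ c j → Node n j → 0ℚ ≤q nodeSlack c j
    nodeSlack-nonNeg c j nd = if-nonNeg (c j)
      (λ _ → p≤q⇒0≤q-p (proj₂ (sink-bounds j nd)))
      (λ _ → p≤q⇒0≤q-p (proj₂ (source-bounds j nd)))

    arcSlack-nonNeg : ∀ c i j → Node n i → Node n j → 0ℚ ≤q arcSlack c i j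
    arcSlack-nonNeg c i j ni nj = by-cases (j <ᵇ i) (c i) (c j) (λ t → arc-bounds i j (innerArc ni nj t))
      where
        by-cases : ∀ (l ci cj : Bool) {u y} → (T l → 0ℚ ≤q y × y ≤q u) →
             0ℚ ≤q (if l ∧ ci ∧ not cj then u - y else (if l ∧ not ci ∧ cj then y else 0ℚ))
        by-cases false ci    cj    bounds = ≤-refl
        by-cases true  false false bounds = ≤-refl
        by-cases true  false true  bounds = proj₁ (bounds tt)
        by-cases true  true  false bounds = p≤q⇒0≤q-p (proj₂ (bounds tt))
        by-cases true  true  true  bounds = ≤-refl

    arcSlack-total-nonNeg : ∀ c → 0ℚ ≤q ΣΣ (arcSlack c)
    arcSlack-total-nonNeg c =
      sumTo-nonNeg n (λ i ni → sumTo-nonNeg n (λ j nj → arcSlack-nonNeg c i j ni nj))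

    module _ (S : Vec Bool n) (scs : SCS n λ' μ S x) where
      open SCSParts n λ' μ S x scs
      private
        c : ℕ → Bool
        c = inS S

      slack≡0 : slack c ≡ 0ℚ
      slack≡0 = trans (cong₂ _+_ nodes arcs) (+-identityʳ 0ℚ)
        where
          nodes : sumTo n (nodeSlack c) ≡ 0ℚ
          nodes = sumTo-zero n (λ j nd → if-zero (c j)
            (λ t → p≡q⇒q-p≡0 (proj₂ (in-cut j nd t)))
            (λ t → p≡q⇒q-p≡0 (proj₁ (out-cut j nd t))))
          by-cases : ∀ (l ci cj : Bool) {u y} → (T l → T ci → T (not cj) → y ≡ u) →
               (T l → T (not ci) → T cj → y ≡ 0ℚ) →
               (if l ∧ ci ∧ not cj then u - y else (if l ∧ not ci ∧ cj then y else 0ℚ)) ≡ 0ℚ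
          by-cases false ci    cj    saturated empty = refl
          by-cases true  false false saturated empty = refl
          by-cases true  false true  saturated empty = empty tt tt tt
          by-cases true  true  false saturated empty = p≡q⇒q-p≡0 (saturated tt tt tt)
          by-cases true  true  true  saturated empty = refl
          arcs : ΣΣ (arcSlack c) ≡ 0ℚ
          arcs = sumTo-zero n (λ i ni → sumTo-zero n (λ j nj → by-cases (j <ᵇ i) (c i) (c j)
            (λ t → leaving-saturated i j (innerArc ni nj t))
            (λ t → entering-empty i j (innerArc ni nj t))))

      slack-pos : ∀ c′ k → Node n k → c′ k ≢ c k → 0ℚ <q slack c′
      slack-pos c′ k nd c′k≢ck = +-posˡ
        (sumTo-pos n (nodeSlack-nonNeg c′) k nd (by-cases (c k) (c′ k) c′k≢ck
          (λ t → p<q⇒0<q-p (proj₁ (in-cut k nd t)))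
          (λ t → p<q⇒0<q-p (proj₂ (out-cut k nd t)))))
        (arcSlack-total-nonNeg c′)
        where
          by-cases : ∀ (b b′ : Bool) {p r} → b′ ≢ b → (T b → 0ℚ <q r) → (T (not b) → 0ℚ <q p) →
               0ℚ <q (if b′ then p else r)
          by-cases true  true  b′≢b _ _   = ⊥-elim (b′≢b refl)
          by-cases true  false _    0<r _ = 0<r tt
          by-cases false true  _    _ 0<p = 0<p tt
          by-cases false false b′≢b _ _   = ⊥-elim (b′≢b refl)

inS-last : ∀ {m} h (S : Vec Bool m) → inS (h ∷ S) (suc m) ≡ h
inS-last {m} h S = if-T (n≡ᵇn (suc m))

inS-old : ∀ {m} h (S : Vec Bool m) j → j ≤ m → inS (h ∷ S) j ≡ inS S j
inS-old h S j j≤m = if-¬T (<⇒¬≡ᵇ (s≤s j≤m))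

≢⇒inS-differs : ∀ {n} (S S′ : Vec Bool n) → S′ ≢ S → Σ[ j ∈ ℕ ] Node n j × inS S′ j ≢ inS S j
≢⇒inS-differs []      []       S′≢S = ⊥-elim (S′≢S refl)
≢⇒inS-differs {suc m} (h ∷ S) (h′ ∷ S′) S′≢S with h′ Data.Bool.≟ h
... | no h′≢h = suc m , Node-last m , λ e → h′≢h (trans (sym (inS-last h′ S′)) (trans e (inS-last h S)))
... | yes refl with ≢⇒inS-differs S S′ (λ e → S′≢S (cong (h ∷_) e))
...   | j , nd , differs = j , Node-weaken nd ,
        λ e → differs (trans (sym (inS-old h S′ j (proj₂ nd))) (trans e (inS-old h S j (proj₂ nd))))

feasible∧SCS⇒uniqueMinCut : ∀ n λ' μ S x → Feasible n λ' μ x → SCS n λ' μ S x → UniqueMinCut n λ' μ S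
feasible∧SCS⇒uniqueMinCut n λ' μ S x feasible scs S′ S′≢S with ≢⇒inS-differs S S′ S′≢S
... | k , nd , differs = begin-strict
  cutCap n λ' μ S       ≡⟨ cutCap≡value+slack balanced S ⟩
  value + slack (inS S) ≡⟨ cong (value +_) (slack≡0 feasible S scs) ⟩
  value + 0ℚ            ≡⟨ +-identityʳ value ⟩
  value                 <⟨ subst (_<q value + slack (inS S′)) (+-identityʳ value)
                             (+-monoʳ-< value (slack-pos feasible S scs (inS S′) k nd differs)) ⟩
  value + slack (inS S′) ≡⟨ sym (cutCap≡value+slack balanced S′) ⟩
  cutCap n λ' μ S′      ∎
  where open CutDuality n λ' μ x
        open FeasibleParts n λ' μ x feasible using (balanced)
        open ≤-Reasoning

module Unfold (k : ℕ) where
  private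
    K n : ℕ
    K = suc k
    n = suc K

  a-old : ∀ j → j ≤ K → a n j ≡ q 4 * a K j
  a-old j j≤K = if-T (ℕP.<⇒<ᵇ (s≤s j≤K))

  a-last : a n n ≡ φ n
  a-last = if-¬T (n≮ᵇn n)

  b-old : ∀ j → j ≤ K → b n j ≡ (1ℚ + θ n) * b K j
  b-old j j≤K = if-T (ℕP.<⇒<ᵇ (s≤s j≤K))

  uT-old : ∀ j → j ≤ K → uT n j ≡ uT K j + θ n * b K j
  uT-old j j≤K = if-T (ℕP.<⇒<ᵇ (s≤s j≤K))

  uT-last : uT n n ≡ φ n ÷' q 2
  uT-last = if-¬T (n≮ᵇn n)

  uM-old : ∀ i j → i ≤ K → uM n i j ≡ uM K i j
  uM-old i j i≤K = if-¬T (<⇒¬≡ᵇ (s≤s i≤K))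

b-last : ∀ k → b (suc k) (suc k) ≡ 1ℚ
b-last zero    = refl
b-last (suc k) = if-¬T (n≮ᵇn (suc (suc k)))

lastArcCap : ℕ → ℕ → ℚ
lastArcCap k j = θ (suc (suc k)) * b (suc k) j - q 3 * a (suc k) j

uM-last : ∀ k j → uM (suc (suc k)) (suc (suc k)) j ≡ lastArcCap k j
uM-last k j = if-T (n≡ᵇn (suc (suc k)))

record Growth (K : ℕ) : Set where
  field
    a-nonNeg : ∀ j → Node K j → 0ℚ ≤q a K j
    1≤b      : ∀ j → Node K j → 1ℚ ≤q b K j
    a≤a-last : ∀ j → Node K j → a K j ≤q a K K
    1≤a-last : 1ℚ ≤q a K K

0≤1 : 0ℚ ≤q 1ℚ
0≤1 = from-yes (0ℚ ≤? 1ℚ)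

0≤3 : 0ℚ ≤q q 3
0≤3 = from-yes (0ℚ ≤? q 3)

0≤4 : 0ℚ ≤q q 4
0≤4 = from-yes (0ℚ ≤? q 4)

0<4 : 0ℚ <q q 4
0<4 = from-yes (0ℚ <? q 4)

module _ {k : ℕ} (G : Growth (suc k)) where
  open Growth G
  private
    K n : ℕ
    K = suc k
    n = suc K

  θ-nonNeg : 0ℚ ≤q θ n
  θ-nonNeg = *-nonNeg 0≤3 (≤-trans 0≤1 1≤a-last)

  lastArcCap-nonNeg : ∀ j → Node K j → 0ℚ ≤q lastArcCap k j
  lastArcCap-nonNeg j nd = p≤q⇒0≤q-p (begin
    q 3 * a K j        ≤⟨ *-monoˡ-≤-nonNeg′ (q 3) 0≤3 (a≤a-last j nd) ⟩
    θ n                ≡⟨ sym (*-identityʳ (θ n)) ⟩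
    θ n * 1ℚ           ≤⟨ *-monoˡ-≤-nonNeg′ (θ n) θ-nonNeg (1≤b j nd) ⟩
    θ n * b K j        ∎)
    where open ≤-Reasoning

-- The single term u_{n,n-2} of φ^n = 4 Σ_j u_{nj} is already ≥ a^{n-1}_{n-1} =: A:
-- with c = a^{n-2}_{n-2} it equals 3A(1 + 3c) − 12c, and A ≥ 4c.
4a-last≤φ : ∀ k → Growth (suc k) → q 4 * a (suc k) (suc k) ≤q φ (suc (suc k))
4a-last≤φ zero    _ = ≤-refl
4a-last≤φ (suc p) G = *-monoˡ-≤-nonNeg′ (q 4) 0≤4 (begin
  A                          ≤⟨ 0≤q-p⇒p≤q (subst (0ℚ ≤q_) (sym cap-P-A) difference-nonNeg) ⟩
  lastArcCap (suc p) P       ≤⟨ term≤sumTo K (lastArcCap-nonNeg G) P (s≤s z≤n , ℕP.n≤1+n P) ⟩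
  sumTo K (lastArcCap (suc p)) ∎)
  where
    open Growth G
    open ≤-Reasoning
    P K : ℕ
    P = suc p
    K = suc P
    A c : ℚ
    A = a K K
    c = a P P
    nodeP : Node K P
    nodeP = s≤s z≤n , ℕP.n≤1+n P
    4c≤A : q 4 * c ≤q A
    4c≤A = subst (_≤q A) (Unfold.a-old p P ℕP.≤-refl) (a≤a-last P nodeP)
    0≤c : 0ℚ ≤q c
    0≤c = ≤-by-factor (q 4) 0<4 (*-zeroʳ (q 4)) refl
            (subst (0ℚ ≤q_) (Unfold.a-old p P ℕP.≤-refl) (a-nonNeg P nodeP))
    0≤9A-4 : 0ℚ ≤q (q 9 * A) - q 4
    0≤9A-4 = p≤q⇒0≤q-p (≤-trans (from-yes (q 4 ≤? q 9))
             (subst (_≤q q 9 * A) (*-identityʳ (q 9)) (*-monoˡ-≤-nonNeg′ (q 9) (from-yes (0ℚ ≤? q 9)) 1≤a-last)))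
    cap-P-A : lastArcCap (suc p) P - A ≡ ((A - q 4 * c) + (A - q 4 * c)) + c * (q 9 * A - q 4)
    cap-P-A = begin-equality
      (q 3 * A) * b K P - q 3 * a K P - A
        ≡⟨ cong₂ (λ u v → (q 3 * A) * u - q 3 * v - A)
             (trans (Unfold.b-old p P ℕP.≤-refl) (cong ((1ℚ + q 3 * c) *_) (b-last p)))
             (Unfold.a-old p P ℕP.≤-refl) ⟩
      (q 3 * A) * ((1ℚ + q 3 * c) * 1ℚ) - q 3 * (q 4 * c) - A
        ≡⟨ solve 2 (λ A c → ((con (q 3) :* A) :* ((con 1ℚ :+ con (q 3) :* c) :* con 1ℚ)
                              :- con (q 3) :* (con (q 4) :* c)) :- A
                            := ((A :- con (q 4) :* c) :+ (A :- con (q 4) :* c))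
                               :+ c :* (con (q 9) :* A :- con (q 4))) refl A c ⟩
      ((A - q 4 * c) + (A - q 4 * c)) + c * (q 9 * A - q 4) ∎
    difference-nonNeg : 0ℚ ≤q ((A - q 4 * c) + (A - q 4 * c)) + c * (q 9 * A - q 4)
    difference-nonNeg = +-nonNeg (+-nonNeg (p≤q⇒0≤q-p 4c≤A) (p≤q⇒0≤q-p 4c≤A)) (*-nonNeg 0≤c 0≤9A-4)

4≤φ : ∀ k → Growth (suc k) → q 4 ≤q φ (suc (suc k))
4≤φ k G = ≤-trans (subst (_≤q q 4 * a (suc k) (suc k)) (*-identityʳ (q 4))
                     (*-monoˡ-≤-nonNeg′ (q 4) 0≤4 (Growth.1≤a-last G)))
                  (4a-last≤φ k G)

growth : ∀ k → Growth (suc k)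
growth zero    = record
  { a-nonNeg = λ _ _ → 0≤1 ; 1≤b = λ _ _ → ≤-refl ; a≤a-last = λ _ _ → ≤-refl ; 1≤a-last = ≤-refl }
growth (suc k) = record
  { a-nonNeg = a-nonNeg′ ; 1≤b = 1≤b′ ; a≤a-last = a≤a-last′ ; 1≤a-last = 1≤a-last′ }
  where
    open Growth (growth k)
    open Unfold k
    K n : ℕ
    K = suc k
    n = suc K
    4A≤φ : q 4 * a K K ≤q φ n
    4A≤φ = 4a-last≤φ k (growth k)
    0≤φ : 0ℚ ≤q φ n
    0≤φ = ≤-trans (*-nonNeg 0≤4 (≤-trans 0≤1 1≤a-last)) 4A≤φ
    a-nonNeg′ : ∀ j → Node n j → 0ℚ ≤q a n j
    a-nonNeg′ j nd with Node-split nd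
    ... | inj₁ refl = subst (0ℚ ≤q_) (sym a-last) 0≤φ
    ... | inj₂ nd′  = subst (0ℚ ≤q_) (sym (a-old j (proj₂ nd′))) (*-nonNeg 0≤4 (a-nonNeg j nd′))
    1≤b′ : ∀ j → Node n j → 1ℚ ≤q b n j
    1≤b′ j nd with Node-split nd
    ... | inj₁ refl = ≤-reflexive (sym (b-last K))
    ... | inj₂ nd′  = subst (1ℚ ≤q_) (sym (b-old j (proj₂ nd′))) (begin
      1ℚ                    ≤⟨ 1≤b j nd′ ⟩
      b K j                 ≡⟨ sym (*-identityˡ (b K j)) ⟩
      1ℚ * b K j            ≤⟨ *-monoʳ-≤-nonNeg (b K j) {{nonNegative (≤-trans 0≤1 (1≤b j nd′))}}
                                 (subst (_≤q 1ℚ + θ n) (+-identityʳ 1ℚ) (+-monoʳ-≤ 1ℚ (θ-nonNeg (growth k)))) ⟩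
      (1ℚ + θ n) * b K j    ∎)
      where open ≤-Reasoning
    a≤a-last′ : ∀ j → Node n j → a n j ≤q a n n
    a≤a-last′ j nd with Node-split nd
    ... | inj₁ refl = ≤-refl
    ... | inj₂ nd′  = subst₂ _≤q_ (sym (a-old j (proj₂ nd′))) (sym a-last)
                        (≤-trans (*-monoˡ-≤-nonNeg′ (q 4) 0≤4 (a≤a-last j nd′)) 4A≤φ)
    1≤a-last′ : 1ℚ ≤q a n n
    1≤a-last′ = subst (1ℚ ≤q_) (sym a-last) (≤-trans (from-yes (1ℚ ≤? q 4)) (4≤φ k (growth k)))

-- φ² = 4 while u²₂₁ = 0; for n > 2 the bound is the definition of φ^n.
4ΣlastArcCap≤φ : ∀ k → q 4 * sumTo (suc k) (lastArcCap k) ≤q φ (suc (suc k))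
4ΣlastArcCap≤φ zero    = from-yes (q 4 * sumTo 1 (lastArcCap 0) ≤? φ 2)
4ΣlastArcCap≤φ (suc k) = ≤-refl

InnerArc-split : ∀ {K i j} → InnerArc (suc K) i j → (i ≡ suc K × Node K j) ⊎ InnerArc K i j
InnerArc-split (1≤j , j<i , i≤1+K) with ℕP.m≤n⇒m<n∨m≡n i≤1+K
... | inj₂ refl       = inj₁ (refl , 1≤j , ℕP.≤-pred j<i)
... | inj₁ (s≤s i≤K) = inj₂ (1≤j , j<i , i≤K)

InnerArc-target : ∀ {K i j} → InnerArc K i j → Node K j
InnerArc-target (1≤j , j<i , i≤K) = 1≤j , ℕP.≤-trans (ℕP.<⇒≤ j<i) i≤K

balanced-last : ∀ K (x : Flow) → x (sArc (suc K)) ≡ x (tArc (suc K)) + sumTo K (λ j → x (mArc (suc K) j)) →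
                inflow (suc K) x (suc K) ≡ outflow (suc K) x (suc K)
balanced-last K x balance = begin
  x (sArc (suc K)) + sumTo (suc K) (λ i → if suc K <ᵇ i then x (mArc i (suc K)) else 0ℚ)
    ≡⟨ cong (x (sArc (suc K)) +_) (sumTo-zero (suc K) (λ i nd → if-¬T (≤⇒¬<ᵇ (proj₂ nd)))) ⟩
  x (sArc (suc K)) + 0ℚ
    ≡⟨ +-identityʳ _ ⟩
  x (sArc (suc K))
    ≡⟨ balance ⟩
  x (tArc (suc K)) + sumTo K (λ j → x (mArc (suc K) j))
    ≡⟨ cong (x (tArc (suc K)) +_) (sym (trans (cong₂ _+_ below (if-¬T (n≮ᵇn (suc K)))) (+-identityʳ _))) ⟩
  x (tArc (suc K)) + sumTo (suc K) (λ j → if j <ᵇ suc K then x (mArc (suc K) j) else 0ℚ) ∎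
  where
    open ≡-Reasoning
    below : sumTo K (λ j → if j <ᵇ suc K then x (mArc (suc K) j) else 0ℚ) ≡ sumTo K (λ j → x (mArc (suc K) j))
    below = sumTo-cong K (λ j nd → if-T (ℕP.<⇒<ᵇ (s≤s (proj₂ nd))))

balanced-extend : ∀ K (x x′ : Flow) j → j ≤ K → {cs ct : ℚ} →
  (∀ i → i ≤ K → x (mArc i j) ≡ x′ (mArc i j)) → (∀ i → x (mArc j i) ≡ x′ (mArc j i)) →
  x (sArc j) ≡ x′ (sArc j) + cs → x (tArc j) ≡ x′ (tArc j) + ct → cs + x (mArc (suc K) j) ≡ ct →
  inflow K x′ j ≡ outflow K x′ j → inflow (suc K) x j ≡ outflow (suc K) x j
balanced-extend K x x′ j j≤K {cs} {ct} same-in same-out src snk shift balance′ = begin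
  x (sArc j) + (sumTo K into + into (suc K))
    ≡⟨ cong₂ _+_ src (cong₂ _+_ (sumTo-cong K (λ i nd → cong (λ v → if j <ᵇ i then v else 0ℚ) (same-in i (proj₂ nd))))
                                (if-T (ℕP.<⇒<ᵇ (s≤s j≤K)))) ⟩
  (x′ (sArc j) + cs) + (in′ + x (mArc (suc K) j))
    ≡⟨ solve 4 (λ s i c m → (s :+ c) :+ (i :+ m) := (s :+ i) :+ (c :+ m)) refl (x′ (sArc j)) in′ cs _ ⟩
  (x′ (sArc j) + in′) + (cs + x (mArc (suc K) j))
    ≡⟨ cong₂ _+_ balance′ shift ⟩
  (x′ (tArc j) + out′) + ct
    ≡⟨ solve 3 (λ t o c → (t :+ o) :+ c := (t :+ c) :+ (o :+ con 0ℚ)) refl (x′ (tArc j)) out′ ct ⟩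
  (x′ (tArc j) + ct) + (out′ + 0ℚ)
    ≡⟨ sym (cong₂ _+_ snk (cong₂ _+_ (sumTo-cong K (λ i _ → cong (λ v → if i <ᵇ j then v else 0ℚ) (same-out i)))
                                    (if-¬T (≤⇒¬<ᵇ (ℕP.m≤n⇒m≤1+n j≤K))))) ⟩
  x (tArc j) + (sumTo K outof + outof (suc K)) ∎
  where
    open ≡-Reasoning
    into outof : ℕ → ℚ
    into  i = if j <ᵇ i then x (mArc i j) else 0ℚ
    outof i = if i <ᵇ j then x (mArc j i) else 0ℚ
    in′ out′ : ℚ
    in′  = sumTo K (λ i → if j <ᵇ i then x′ (mArc i j) else 0ℚ)
    out′ = sumTo K (λ i → if i <ᵇ j then x′ (mArc j i) else 0ℚ)

module _ (k : ℕ) where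
  private
    K n : ℕ
    K = suc k
    n = suc K

  sourceShift : Bool → ℕ → ℚ
  sourceShift h j = if h then q 3 * a K j else θ n * b K j

  flow-sArc-old : ∀ h (S : Vec Bool K) j → j ≤ K →
                  flow n (h ∷ S) (sArc j) ≡ flow K S (sArc j) + sourceShift h j
  flow-sArc-old false S j j≤K = if-¬T (<⇒¬≡ᵇ (s≤s j≤K))
  flow-sArc-old true  S j j≤K = if-¬T (<⇒¬≡ᵇ (s≤s j≤K))

  flow-tArc-old : ∀ h (S : Vec Bool K) j → j ≤ K →
                  flow n (h ∷ S) (tArc j) ≡ flow K S (tArc j) + θ n * b K j
  flow-tArc-old false S j j≤K = if-¬T (<⇒¬≡ᵇ (s≤s j≤K))
  flow-tArc-old true  S j j≤K = if-¬T (<⇒¬≡ᵇ (s≤s j≤K))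

  flow-mArc-old : ∀ h (S : Vec Bool K) i j → i ≤ K → flow n (h ∷ S) (mArc i j) ≡ flow K S (mArc i j)
  flow-mArc-old false S i j i≤K = if-¬T (<⇒¬≡ᵇ (s≤s i≤K))
  flow-mArc-old true  S i j i≤K = if-¬T (<⇒¬≡ᵇ (s≤s i≤K))

  flow-mArc-last : ∀ h (S : Vec Bool K) j →
                   flow n (h ∷ S) (mArc n j) ≡ (if h then lastArcCap k j else 0ℚ)
  flow-mArc-last false S j = if-T (n≡ᵇn n)
  flow-mArc-last true  S j = if-T (n≡ᵇn n)

  lastArc-balance : ∀ h j → sourceShift h j + (if h then lastArcCap k j else 0ℚ) ≡ θ n * b K j
  lastArc-balance false j = +-identityʳ _
  lastArc-balance true  j = solve 2 (λ u v → u :+ (v :- u) := v) refl (q 3 * a K j) (θ n * b K j)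

  lam-step : ∀ h (S : Vec Bool K) → q 4 * lam n (h ∷ S) ≡ lam K S + (if h then q 3 else 0ℚ)
  lam-step false S = trans (*-÷′-cancel (lam K S) (q 4) 0<4) (sym (+-identityʳ _))
  lam-step true  S = *-÷′-cancel (lam K S + q 3) (q 4) 0<4

  module _ (0<1+θ : 0ℚ <q 1ℚ + θ n) where

    mu-step : ∀ h (S : Vec Bool K) → (1ℚ + θ n) * mu n (h ∷ S) ≡ mu K S + (if h then 0ℚ else θ n)
    mu-step false S = *-÷′-cancel (mu K S + θ n) (1ℚ + θ n) 0<1+θ
    mu-step true  S = trans (*-÷′-cancel (mu K S) (1ℚ + θ n) 0<1+θ) (sym (+-identityʳ _))

    uS-old : ∀ h (S : Vec Bool K) j → j ≤ K →
             uS n (lam n (h ∷ S)) (mu n (h ∷ S)) j ≡ uS K (lam K S) (mu K S) j + sourceShift h j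
    uS-old h S j j≤K = begin
      a n j * L + b n j * M
        ≡⟨ cong₂ _+_ (cong (_* L) (Unfold.a-old k j j≤K)) (cong (_* M) (Unfold.b-old k j j≤K)) ⟩
      (q 4 * a K j) * L + ((1ℚ + θ n) * b K j) * M
        ≡⟨ solve 5 (λ α L β t M → (con (q 4) :* α) :* L :+ ((con 1ℚ :+ t) :* β) :* M
                                 := α :* (con (q 4) :* L) :+ β :* ((con 1ℚ :+ t) :* M)) refl (a K j) L (b K j) (θ n) M ⟩
      a K j * (q 4 * L) + b K j * ((1ℚ + θ n) * M)
        ≡⟨ cong₂ (λ u v → a K j * u + b K j * v) (lam-step h S) (mu-step h S) ⟩
      a K j * (lam K S + ε h) + b K j * (mu K S + δ h)
        ≡⟨ solve 6 (λ α L e β M d → α :* (L :+ e) :+ β :* (M :+ d) := (α :* L :+ β :* M) :+ (α :* e :+ β :* d))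
             refl (a K j) (lam K S) (ε h) (b K j) (mu K S) (δ h) ⟩
      uS K (lam K S) (mu K S) j + (a K j * ε h + b K j * δ h)
        ≡⟨ cong (uS K (lam K S) (mu K S) j +_) (shift h) ⟩
      uS K (lam K S) (mu K S) j + sourceShift h j ∎
      where
        open ≡-Reasoning
        L = lam n (h ∷ S)
        M = mu n (h ∷ S)
        ε δ : Bool → ℚ
        ε h = if h then q 3 else 0ℚ
        δ h = if h then 0ℚ else θ n
        shift : ∀ h → a K j * ε h + b K j * δ h ≡ sourceShift h j
        shift false = solve 3 (λ α β t → α :* con 0ℚ :+ β :* t := t :* β) refl (a K j) (b K j) (θ n)
        shift true  = solve 2 (λ α β → α :* con (q 3) :+ β :* con 0ℚ := con (q 3) :* α) refl (a K j) (b K j)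

  uS-last : ∀ L M → uS n L M n ≡ φ n * L + M
  uS-last L M = cong₂ _+_ (cong (_* L) (Unfold.a-last k)) (trans (cong (_* M) (b-last K)) (*-identityˡ M))

-- The bounds on the point are what the next induction step needs.
record Certificate (n : ℕ) (S : Vec Bool n) : Set where
  field
    feasible : Feasible n (lam n S) (mu n S) (flow n S)
    scs      : SCS n (lam n S) (mu n S) S (flow n S)
    0<λ      : 0ℚ <q lam n S
    λ<1      : lam n S <q 1ℚ
    0<μ      : 0ℚ <q mu n S
    μ<1      : mu n S <q 1ℚ

shift-bounds : ∀ {p u c P U} → P ≡ p + c → U ≡ u + c → 0ℚ ≤q c → 0ℚ ≤q p × p ≤q u → 0ℚ ≤q P × P ≤q U
shift-bounds refl refl 0≤c (0≤p , p≤u) = +-nonNeg 0≤p 0≤c , +-monoˡ-≤ _ p≤u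

shift-< : ∀ {p u c P U} → P ≡ p + c → U ≡ u + c → p <q u → P <q U
shift-< refl refl p<u = +-monoˡ-< _ p<u

shift-≡ : ∀ {p u c P U} → P ≡ p + c → U ≡ u + c → p ≡ u → P ≡ U
shift-≡ refl refl refl = refl

module Extend (k : ℕ) (h : Bool) (S : Vec Bool (suc k)) (old : Certificate (suc k) S) where
  K n : ℕ
  K = suc k
  n = suc K

  L M : ℚ
  L = lam n (h ∷ S)
  M = mu n (h ∷ S)

  x : Flow
  x = flow n (h ∷ S)

  open Growth (growth k)
  module Old = Certificate old
  module OldFlow = FeasibleParts K (lam K S) (mu K S) (flow K S) Old.feasible
  module OldCut = SCSParts K (lam K S) (mu K S) S (flow K S) Old.scs

  0≤θ : 0ℚ ≤q θ n
  0≤θ = θ-nonNeg (growth k)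

  0<1+θ : 0ℚ <q 1ℚ + θ n
  0<1+θ = +-posˡ (from-yes (0ℚ <? 1ℚ)) 0≤θ

  0≤φ : 0ℚ ≤q φ n
  0≤φ = ≤-trans 0≤4 (4≤φ k (growth k))

  4[φ/2]≡φ+φ : q 4 * (φ n ÷' q 2) ≡ φ n + φ n
  4[φ/2]≡φ+φ = trans (solve 1 (λ y → con (q 4) :* y := con (q 2) :* y :+ con (q 2) :* y) refl (φ n ÷' q 2))
                      (cong₂ _+_ φ/2 φ/2)
    where φ/2 : q 2 * (φ n ÷' q 2) ≡ φ n
          φ/2 = *-÷′-cancel (φ n) (q 2) (from-yes (0ℚ <? q 2))

  0≤φ/2 : 0ℚ ≤q φ n ÷' q 2
  0≤φ/2 = ≤-by-factor (q 4) 0<4 (*-zeroʳ (q 4)) 4[φ/2]≡φ+φ (+-nonNeg 0≤φ 0≤φ)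

  0≤sourceShift : ∀ j → Node K j → 0ℚ ≤q sourceShift k h j
  0≤sourceShift j nd = if-nonNeg h (λ _ → *-nonNeg 0≤3 (a-nonNeg j nd))
                                   (λ _ → *-nonNeg 0≤θ (≤-trans 0≤1 (1≤b j nd)))

  0≤sinkShift : ∀ j → Node K j → 0ℚ ≤q θ n * b K j
  0≤sinkShift j nd = *-nonNeg 0≤θ (≤-trans 0≤1 (1≤b j nd))

  λ-bounds : 0ℚ <q L × L <q 1ℚ
  λ-bounds = <-by-factor (q 4) 0≤4 (*-zeroʳ (q 4)) (lam-step k h S) (+-posˡ Old.0<λ (0≤ε h)) ,
             <-by-factor (q 4) 0≤4 (lam-step k h S) (*-identityʳ (q 4))
               (<-≤-trans (+-mono-<-≤ Old.λ<1 (ε≤3 h)) (from-yes (1ℚ + q 3 ≤? q 4)))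
    where
      0≤ε : ∀ h → 0ℚ ≤q (if h then q 3 else 0ℚ)
      0≤ε h = if-nonNeg h (λ _ → 0≤3) (λ _ → ≤-refl)
      ε≤3 : ∀ h → (if h then q 3 else 0ℚ) ≤q q 3
      ε≤3 false = 0≤3
      ε≤3 true  = ≤-refl

  μ-bounds : 0ℚ <q M × M <q 1ℚ
  μ-bounds = <-by-factor (1ℚ + θ n) (<⇒≤ 0<1+θ) (*-zeroʳ (1ℚ + θ n)) (mu-step k 0<1+θ h S) (+-posˡ Old.0<μ (0≤δ h)) ,
             <-by-factor (1ℚ + θ n) (<⇒≤ 0<1+θ) (mu-step k 0<1+θ h S) (*-identityʳ (1ℚ + θ n))
               (+-mono-<-≤ Old.μ<1 (δ≤θ h))
    where
      0≤δ : ∀ h → 0ℚ ≤q (if h then 0ℚ else θ n)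
      0≤δ h = if-nonNeg h (λ _ → ≤-refl) (λ _ → 0≤θ)
      δ≤θ : ∀ h → (if h then 0ℚ else θ n) ≤q θ n
      δ≤θ false = ≤-refl
      δ≤θ true  = 0≤θ

  old-member : ∀ {j} → j ≤ K → T (inS (h ∷ S) j) → T (inS S j)
  old-member {j} j≤K = subst T (inS-old h S j j≤K)

  old-nonmember : ∀ {j} → j ≤ K → T (not (inS (h ∷ S) j)) → T (not (inS S j))
  old-nonmember {j} j≤K = subst (λ b → T (not b)) (inS-old h S j j≤K)

  module _ {j} (nd : Node K j) where
    private
      j≤K : j ≤ K
      j≤K = proj₂ nd
      src-eq : x (sArc j) ≡ flow K S (sArc j) + sourceShift k h j
      src-eq = flow-sArc-old k h S j j≤K
      cap-eq : uS n L M j ≡ uS K (lam K S) (mu K S) j + sourceShift k h j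
      cap-eq = uS-old k 0<1+θ h S j j≤K
      snk-eq : x (tArc j) ≡ flow K S (tArc j) + θ n * b K j
      snk-eq = flow-tArc-old k h S j j≤K
      snk-cap-eq : uT n j ≡ uT K j + θ n * b K j
      snk-cap-eq = Unfold.uT-old k j j≤K

    source-bounds-old : 0ℚ ≤q x (sArc j) × x (sArc j) ≤q uS n L M j
    source-bounds-old = shift-bounds src-eq cap-eq (0≤sourceShift j nd) (OldFlow.source-bounds j nd)

    sink-bounds-old : 0ℚ ≤q x (tArc j) × x (tArc j) ≤q uT n j
    sink-bounds-old = shift-bounds snk-eq snk-cap-eq (0≤sinkShift j nd) (OldFlow.sink-bounds j nd)

    in-cut-old : T (inS (h ∷ S) j) → x (sArc j) <q uS n L M j × x (tArc j) ≡ uT n j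
    in-cut-old t = map (shift-< src-eq cap-eq) (shift-≡ snk-eq snk-cap-eq) (OldCut.in-cut j nd (old-member j≤K t))

    out-cut-old : T (not (inS (h ∷ S) j)) → x (sArc j) ≡ uS n L M j × x (tArc j) <q uT n j
    out-cut-old t = map (shift-≡ src-eq cap-eq) (shift-< snk-eq snk-cap-eq) (OldCut.out-cut j nd (old-nonmember j≤K t))

    balanced-old : inflow n x j ≡ outflow n x j
    balanced-old = balanced-extend K x (flow K S) j j≤K
      (λ i i≤K → flow-mArc-old k h S i j i≤K) (λ i → flow-mArc-old k h S j i j≤K)
      src-eq snk-eq (trans (cong (sourceShift k h j +_) (flow-mArc-last k h S j)) (lastArc-balance k h j))
      (OldFlow.balanced j nd)

    arc-last-bounds : 0ℚ ≤q x (mArc n j) × x (mArc n j) ≤q uM n n j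
    arc-last-bounds = subst (λ y → 0ℚ ≤q y × y ≤q uM n n j) (sym (flow-mArc-last k h S j)) (bounds h)
      where
        0≤cap : 0ℚ ≤q lastArcCap k j
        0≤cap = lastArcCap-nonNeg (growth k) j nd
        bounds : ∀ h → 0ℚ ≤q (if h then lastArcCap k j else 0ℚ) × (if h then lastArcCap k j else 0ℚ) ≤q uM n n j
        bounds false = ≤-refl , subst (0ℚ ≤q_) (sym (uM-last k j)) 0≤cap
        bounds true  = 0≤cap , ≤-reflexive (sym (uM-last k j))

  arc-last-leaving : ∀ j → T h → x (mArc n j) ≡ uM n n j
  arc-last-leaving j t = trans (flow-mArc-last k h S j) (capacity-if-inside h t)
    where capacity-if-inside : ∀ h → T h → (if h then lastArcCap k j else 0ℚ) ≡ uM n n j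
          capacity-if-inside true _ = sym (uM-last k j)

  arc-last-entering : ∀ j → T (not h) → x (mArc n j) ≡ 0ℚ
  arc-last-entering j t = trans (flow-mArc-last k h S j) (zero-if-outside h t)
    where zero-if-outside : ∀ h → T (not h) → (if h then lastArcCap k j else 0ℚ) ≡ 0ℚ
          zero-if-outside false _ = refl

  module _ {i j} (ia : InnerArc K i j) where
    private
      i≤K : i ≤ K
      i≤K = proj₂ (proj₂ ia)
      j≤K : j ≤ K
      j≤K = proj₂ (InnerArc-target ia)
      arc-eq : x (mArc i j) ≡ flow K S (mArc i j)
      arc-eq = flow-mArc-old k h S i j i≤K
      cap-eq : uM n i j ≡ uM K i j
      cap-eq = Unfold.uM-old k i j i≤K

    arc-bounds-old : 0ℚ ≤q x (mArc i j) × x (mArc i j) ≤q uM n i j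
    arc-bounds-old = subst₂ (λ y u → 0ℚ ≤q y × y ≤q u) (sym arc-eq) (sym cap-eq) (OldFlow.arc-bounds i j ia)

    leaving-old : T (inS (h ∷ S) i) → T (not (inS (h ∷ S) j)) → x (mArc i j) ≡ uM n i j
    leaving-old ti tj = trans arc-eq (trans
      (OldCut.leaving-saturated i j ia (old-member i≤K ti) (old-nonmember j≤K tj))
      (sym cap-eq))

    entering-old : T (not (inS (h ∷ S) i)) → T (inS (h ∷ S) j) → x (mArc i j) ≡ 0ℚ
    entering-old ti tj = trans arc-eq
      (OldCut.entering-empty i j ia (old-nonmember i≤K ti) (old-member j≤K tj))

  extend : 0ℚ ≤q x (sArc n) → 0ℚ ≤q x (tArc n) →
           (T h → x (sArc n) <q uS n L M n × x (tArc n) ≡ uT n n) →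
           (T (not h) → x (sArc n) ≡ uS n L M n × x (tArc n) <q uT n n) →
           x (sArc n) ≡ x (tArc n) + sumTo K (λ j → x (mArc n j)) →
           Certificate n (h ∷ S)
  extend 0≤xs 0≤xt in-cut-last out-cut-last balance-last = record
    { feasible = source-bounds , sink-bounds , arc-bounds , balanced
    ; scs      = in-cut , out-cut , leaving , entering
    ; 0<λ      = proj₁ λ-bounds
    ; λ<1      = proj₂ λ-bounds
    ; 0<μ      = proj₁ μ-bounds
    ; μ<1      = proj₂ μ-bounds
    }
    where
      last-≤ : ∀ h → (T h → x (sArc n) <q uS n L M n × x (tArc n) ≡ uT n n) →
               (T (not h) → x (sArc n) ≡ uS n L M n × x (tArc n) <q uT n n) →
               x (sArc n) ≤q uS n L M n × x (tArc n) ≤q uT n n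
      last-≤ false _ out = ≤-reflexive (proj₁ (out _)) , <⇒≤ (proj₂ (out _))
      last-≤ true  in′ _ = <⇒≤ (proj₁ (in′ _)) , ≤-reflexive (proj₂ (in′ _))

      member-last : T (inS (h ∷ S) n) → T h
      member-last = subst T (inS-last h S)

      nonmember-last : T (not (inS (h ∷ S) n)) → T (not h)
      nonmember-last = subst (λ b → T (not b)) (inS-last h S)

      source-bounds : ∀ j → Node n j → 0ℚ ≤q x (sArc j) × x (sArc j) ≤q uS n L M j
      source-bounds j nd with Node-split nd
      ... | inj₁ refl = 0≤xs , proj₁ (last-≤ h in-cut-last out-cut-last)
      ... | inj₂ nd′  = source-bounds-old nd′

      sink-bounds : ∀ j → Node n j → 0ℚ ≤q x (tArc j) × x (tArc j) ≤q uT n j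
      sink-bounds j nd with Node-split nd
      ... | inj₁ refl = 0≤xt , proj₂ (last-≤ h in-cut-last out-cut-last)
      ... | inj₂ nd′  = sink-bounds-old nd′

      arc-bounds : ∀ i j → InnerArc n i j → 0ℚ ≤q x (mArc i j) × x (mArc i j) ≤q uM n i j
      arc-bounds i j ia with InnerArc-split ia
      ... | inj₁ (refl , nd′) = arc-last-bounds nd′
      ... | inj₂ ia′          = arc-bounds-old ia′

      balanced : ∀ j → Node n j → inflow n x j ≡ outflow n x j
      balanced j nd with Node-split nd
      ... | inj₁ refl = balanced-last K x balance-last
      ... | inj₂ nd′  = balanced-old nd′

      in-cut : ∀ j → Node n j → T (inS (h ∷ S) j) → x (sArc j) <q uS n L M j × x (tArc j) ≡ uT n j
      in-cut j nd t with Node-split nd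
      ... | inj₁ refl = in-cut-last (member-last t)
      ... | inj₂ nd′  = in-cut-old nd′ t

      out-cut : ∀ j → Node n j → T (not (inS (h ∷ S) j)) → x (sArc j) ≡ uS n L M j × x (tArc j) <q uT n j
      out-cut j nd t with Node-split nd
      ... | inj₁ refl = out-cut-last (nonmember-last t)
      ... | inj₂ nd′  = out-cut-old nd′ t

      leaving : ∀ i j → InnerArc n i j → T (inS (h ∷ S) i) → T (not (inS (h ∷ S) j)) → x (mArc i j) ≡ uM n i j
      leaving i j ia ti tj with InnerArc-split ia
      ... | inj₁ (refl , _) = arc-last-leaving j (member-last ti)
      ... | inj₂ ia′        = leaving-old ia′ ti tj

      entering : ∀ i j → InnerArc n i j → T (not (inS (h ∷ S) i)) → T (inS (h ∷ S) j) → x (mArc i j) ≡ 0ℚ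
      entering i j ia ti tj with InnerArc-split ia
      ... | inj₁ (refl , _) = arc-last-entering j (nonmember-last ti)
      ... | inj₂ ia′        = entering-old ia′ ti tj

module LastOutside (k : ℕ) (S : Vec Bool (suc k)) (old : Certificate (suc k) S) where
  open Extend k false S old

  X : ℚ
  X = φ n * L + M

  source-last : x (sArc n) ≡ X
  source-last = if-T (n≡ᵇn n)

  sink-last : x (tArc n) ≡ X
  sink-last = if-T (n≡ᵇn n)

  0≤X : 0ℚ ≤q X
  0≤X = +-nonNeg (*-nonNeg 0≤φ (<⇒≤ (proj₁ λ-bounds))) (<⇒≤ (proj₁ μ-bounds))

  -- multiplied by 4: φλ′ + 4μ < φ + φ
  X<φ/2 : X <q φ n ÷' q 2
  X<φ/2 = <-by-factor (q 4) 0≤4 4X≡ 4[φ/2]≡φ+φ (+-mono-≤-< φλ′≤φ 4μ<φ)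
    where
      4X≡ : q 4 * X ≡ φ n * lam K S + q 4 * M
      4X≡ = trans (solve 3 (λ f l m → con (q 4) :* (f :* l :+ m) := f :* (con (q 4) :* l) :+ con (q 4) :* m)
                     refl (φ n) L M)
                  (cong (λ u → φ n * u + q 4 * M) (trans (lam-step k false S) (+-identityʳ _)))
      φλ′≤φ : φ n * lam K S ≤q φ n
      φλ′≤φ = subst (φ n * lam K S ≤q_) (*-identityʳ (φ n)) (*-monoˡ-≤-nonNeg′ (φ n) 0≤φ (<⇒≤ Old.λ<1))
      4μ<φ : q 4 * M <q φ n
      4μ<φ = <-≤-trans (subst (q 4 * M <q_) (*-identityʳ (q 4)) (*-monoʳ-<-pos′ (q 4) 0<4 (proj₂ μ-bounds))) (4≤φ k (growth k))

  certificate : Certificate n (false ∷ S)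
  certificate = extend
    (subst (0ℚ ≤q_) (sym source-last) 0≤X)
    (subst (0ℚ ≤q_) (sym sink-last) 0≤X)
    (λ ())
    (λ _ → trans source-last (sym (uS-last k L M)) , subst₂ _<q_ (sym sink-last) (sym (Unfold.uT-last k)) X<φ/2)
    (trans source-last (trans (sym (+-identityʳ X))
      (cong₂ _+_ (sym sink-last) (sym (sumTo-zero K (λ j _ → flow-mArc-last k false S j))))))

module LastInside (k : ℕ) (S : Vec Bool (suc k)) (old : Certificate (suc k) S) where
  open Extend k true S old

  Σcap : ℚ
  Σcap = sumTo K (lastArcCap k)

  source-last : x (sArc n) ≡ φ n ÷' q 2 + Σcap
  source-last = if-T (n≡ᵇn n)

  sink-last : x (tArc n) ≡ φ n ÷' q 2
  sink-last = if-T (n≡ᵇn n)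

  0≤Σcap : 0ℚ ≤q Σcap
  0≤Σcap = sumTo-nonNeg K (lastArcCap-nonNeg (growth k))

  -- multiplied by 4: 2φ + 4Σ ≤ 3φ < φ(λ′ + 3) + 4μ
  source-last<cap : φ n ÷' q 2 + Σcap <q φ n * L + M
  source-last<cap = <-by-factor (q 4) 0≤4 lhs≡ rhs≡ (≤-<-trans (+-monoʳ-≤ (φ n + φ n) (4ΣlastArcCap≤φ k)) 3φ<)
    where
      lhs≡ : q 4 * (φ n ÷' q 2 + Σcap) ≡ (φ n + φ n) + q 4 * Σcap
      lhs≡ = trans (*-distribˡ-+ (q 4) (φ n ÷' q 2) Σcap) (cong (_+ q 4 * Σcap) 4[φ/2]≡φ+φ)
      rhs≡ : q 4 * (φ n * L + M) ≡ φ n * (lam K S + q 3) + q 4 * M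
      rhs≡ = trans (solve 3 (λ f l m → con (q 4) :* (f :* l :+ m) := f :* (con (q 4) :* l) :+ con (q 4) :* m)
                      refl (φ n) L M)
                   (cong (λ u → φ n * u + q 4 * M) (lam-step k true S))
      3φ< : (φ n + φ n) + φ n <q φ n * (lam K S + q 3) + q 4 * M
      3φ< = 0<q-p⇒p<q (subst (0ℚ <q_)
              (solve 3 (λ f l m → f :* l :+ con (q 4) :* m
                                := (f :* (l :+ con (q 3)) :+ con (q 4) :* m) :- ((f :+ f) :+ f)) refl (φ n) (lam K S) M)
              (+-posʳ (*-nonNeg 0≤φ (<⇒≤ Old.0<λ)) (*-pos 0<4 (proj₁ μ-bounds))))

  certificate : Certificate n (true ∷ S)
  certificate = extend
    (subst (0ℚ ≤q_) (sym source-last) (+-nonNeg 0≤φ/2 0≤Σcap))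
    (subst (0ℚ ≤q_) (sym sink-last) 0≤φ/2)
    (λ _ → subst₂ _<q_ (sym source-last) (sym (uS-last k L M)) source-last<cap ,
           trans sink-last (sym (Unfold.uT-last k)))
    (λ ())
    (trans source-last (cong₂ _+_ (sym sink-last) (sym (sumTo-cong K (λ j _ → flow-mArc-last k true S j)))))

certificate-outside : Certificate 1 (false ∷ [])
certificate-outside = record
  { feasible = (λ _ _ → from-yes (0ℚ ≤? q 1 ÷' q 2) , from-yes (q 1 ÷' q 2 ≤? 1ℚ * (q 1 ÷' q 4) + 1ℚ * (q 1 ÷' q 4)))
             , (λ _ _ → from-yes (0ℚ ≤? q 1 ÷' q 2) , from-yes (q 1 ÷' q 2 ≤? 1ℚ))
             , (λ _ _ _ → ≤-refl , ≤-refl)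
             , (λ { _ (s≤s z≤n , s≤s z≤n) → refl })
  ; scs      = (λ { _ (s≤s z≤n , s≤s z≤n) () })
             , (λ { _ (s≤s z≤n , s≤s z≤n) _ → refl , from-yes (q 1 ÷' q 2 <? 1ℚ) })
             , (λ _ _ _ _ _ → refl)
             , (λ _ _ _ _ _ → refl)
  ; 0<λ = from-yes (0ℚ <? q 1 ÷' q 4)
  ; λ<1 = from-yes (q 1 ÷' q 4 <? 1ℚ)
  ; 0<μ = from-yes (0ℚ <? q 1 ÷' q 4)
  ; μ<1 = from-yes (q 1 ÷' q 4 <? 1ℚ)
  }

certificate-inside : Certificate 1 (true ∷ [])
certificate-inside = record
  { feasible = (λ _ _ → from-yes (0ℚ ≤? 1ℚ) , from-yes (1ℚ ≤? 1ℚ * (q 3 ÷' q 4) + 1ℚ * (q 3 ÷' q 4)))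
             , (λ _ _ → from-yes (0ℚ ≤? 1ℚ) , ≤-refl)
             , (λ _ _ _ → ≤-refl , ≤-refl)
             , (λ { _ (s≤s z≤n , s≤s z≤n) → refl })
  ; scs      = (λ { _ (s≤s z≤n , s≤s z≤n) _ → from-yes (1ℚ <? 1ℚ * (q 3 ÷' q 4) + 1ℚ * (q 3 ÷' q 4)) , refl })
             , (λ { _ (s≤s z≤n , s≤s z≤n) () })
             , (λ _ _ _ _ _ → refl)
             , (λ _ _ _ _ _ → refl)
  ; 0<λ = from-yes (0ℚ <? q 3 ÷' q 4)
  ; λ<1 = from-yes (q 3 ÷' q 4 <? 1ℚ)
  ; 0<μ = from-yes (0ℚ <? q 3 ÷' q 4)
  ; μ<1 = from-yes (q 3 ÷' q 4 <? 1ℚ)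
  }

certificate : ∀ k (S : Vec Bool (suc k)) → Certificate (suc k) S
certificate zero    (false ∷ []) = certificate-outside
certificate zero    (true  ∷ []) = certificate-inside
certificate (suc k) (false ∷ S)  = LastOutside.certificate k S (certificate k S)
certificate (suc k) (true  ∷ S)  = LastInside.certificate k S (certificate k S)

lemma3 : (m : ℕ) → 1 ≤ m → (S : Vec Bool m) →
    Feasible (suc m) (lam (suc m) (false ∷ S)) (mu (suc m) (false ∷ S)) (flow (suc m) (false ∷ S)) ×
    SCS (suc m) (lam (suc m) (false ∷ S)) (mu (suc m) (false ∷ S)) (false ∷ S) (flow (suc m) (false ∷ S)) ×
    UniqueMinCut (suc m) (lam (suc m) (false ∷ S)) (mu (suc m) (false ∷ S)) (false ∷ S)
lemma3 m _ S = feasible , scs , feasible∧SCS⇒uniqueMinCut n (lam n S′) (mu n S′) S′ (flow n S′) feasible scs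
  where
    n : ℕ
    n = suc m
    S′ : Vec Bool n
    S′ = false ∷ S
    open Certificate (certificate m S′)
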